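{- Let $n\ge 1$ and let ${\cal OCT}_n$ be the set of order-preserving full contractions of $X_n=\{1,\dots,n\}$. For integers $1\le p\le k\le n$, the number of $\alpha\in{\cal OCT}_n$ with $h(\alpha)=p$ and $w^+(\alpha)=k$ is $\binom{n-1}{p-1}$.
   Context: Full transformations are maps $\alpha:X_n\to X_n$, written $x\mapsto x\alpha$. Order-preserving: $x\le y\Rightarrow x\alpha\le y\alpha$. Contraction: $|x\alpha-y\alpha|\le|x-y|$ for all $x,y$. $h(\alpha)=|\mathrm{Im}\,\alpha|$, $w^+(\alpha)=\max(\mathrm{Im}\,\alpha)$. -}

module Defs where

open import Data.Nat using (ℕ; zero; suc; _≤_; _+_; ∣_-_∣; _⊔_)
open import Data.Nat.Properties using (_≤?_; _≟_)
open import Data.Fin using (Fin; toℕ)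
import Data.Fin.Properties as FinP
open import Data.Vec using (Vec; []; _∷_; lookup)
open import Data.List using (List; []; _∷_; map; concatMap; filter; length)
open import Data.List.Relation.Unary.Any using (Any)
open import Data.List.Relation.Unary.Any.Properties using ()
import Data.List.Relation.Unary.Any as Any
open import Data.List.Relation.Unary.All using (All)
import Data.List.Relation.Unary.All as All
open import Data.Fin using () renaming (_≤_ to _≤F_)
open import Data.List using (allFin)
open import Relation.Binary.PropositionalEquality using (_≡_)
open import Relation.Nullary using (Dec; yes; no)
open import Relation.Nullary.Decidable using (_×-dec_; _→-dec_)
open import Data.Product using (_×_)

-- X_n = {1,…,n} is modelled by Fin n (element i : Fin n stands for toℕ i + 1).
-- A full transformation α : X_n → X_n is represented by its table of values
-- (Vec (Fin n) n, entry x is xα); this gives decidable equality so that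
-- transformations can be enumerated and counted.
Transformation : ℕ → Set
Transformation n = Vec (Fin n) n

_·_ : ∀ {n} → Fin n → Transformation n → Fin n
x · α = lookup α x

OrderPreserving : ∀ {n} → Transformation n → Set
OrderPreserving {n} α = ∀ (x y : Fin n) → x ≤F y → (x · α) ≤F (y · α)

Contraction : ∀ {n} → Transformation n → Set
Contraction {n} α = ∀ (x y : Fin n) → ∣ toℕ (x · α) - toℕ (y · α) ∣ ≤ ∣ toℕ x - toℕ y ∣

IsOCT : ∀ {n} → Transformation n → Set
IsOCT α = OrderPreserving α × Contraction α

allVecs : (m n : ℕ) → List (Vec (Fin n) m)
allVecs zero    n = [] ∷ []
allVecs (suc m) n = concatMap (λ v → map (_∷ v) (allFin n)) (allVecs m n)

allTransformations : (n : ℕ) → List (Transformation n)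
allTransformations n = allVecs n n

image : ∀ {n} → Transformation n → List (Fin n)
image {n} α = filter (λ y → Any.any? (λ x → FinP._≟_ (x · α) y) (allFin n)) (allFin n)

h : ∀ {n} → Transformation n → ℕ
h α = length (image α)

-- w⁺(α) = max(Im α), as a number in {1,…,n} (0 only for n = 0, where Im α = ∅)
maxList : List ℕ → ℕ
maxList []       = 0
maxList (x ∷ xs) = x ⊔ maxList xs

w⁺ : ∀ {n} → Transformation n → ℕ
w⁺ α = maxList (map (λ y → suc (toℕ y)) (image α))

isOCT? : ∀ {n} (α : Transformation n) → Dec (IsOCT α)
isOCT? {n} α = op? ×-dec ct?
  where
    open import Data.Fin.Properties using (all?)
    import Data.Fin.Properties as FP
    op? : Dec (OrderPreserving α)
    op? = all? λ x → all? λ y → FP._≤?_ x y →-dec FP._≤?_ (x · α) (y · α)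
    ct? : Dec (Contraction α)
    ct? = all? λ x → all? λ y → ∣ toℕ (x · α) - toℕ (y · α) ∣ ≤? ∣ toℕ x - toℕ y ∣

countOCT : (n p k : ℕ) → ℕ
countOCT n p k =
  length (filter (λ α → isOCT? α ×-dec (h α ≟ p) ×-dec (w⁺ α ≟ k))
                 (allTransformations n))

module Submission where

-- The key observation is local: a map α of X_{m+1} (written as its table of
-- values α₀ … α_m) is order-preserving and a contraction iff it is a WALK,
-- i.e. every step α_{i+1} − α_i is 0 or 1.  The image of a walk is then the
-- whole interval [α₀, α_m], so h(α) = α_m − α₀ + 1 and w⁺(α) = α_m + 1.
-- Consequently the transformations counted by the theorem, with h = d + 1
-- and w⁺ = c + 1, are exactly the walks of length m+1 from c − d to c.
-- Such a walk is determined by which d of its m steps go up, and indeed the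
-- number of walks from b to b + d satisfies Pascal's recurrence (split on the
-- second entry), which gives m C d.

open import Defs
open import Data.Nat
  using (ℕ; zero; suc; _+_; _∸_; _≤_; _<_; z≤n; s≤s; s≤s⁻¹; ∣_-_∣)
open import Data.Nat.Properties
open import Data.Nat.Combinatorics using (_C_; nCk+nC[k+1]≡[n+1]C[k+1])
open import Data.Fin using (Fin; toℕ)
import Data.Fin as Fin
import Data.Fin.Properties as FinP
open import Data.Vec using (Vec; []; _∷_; lookup)
open import Data.List using (List; []; _∷_; _++_; filter; length; map; tabulate; allFin; concatMap)
open import Data.List.Properties using (filter-≐; filter-++; filter-all; filter-none; length-++; map-tabulate)
open import Data.List.Relation.Unary.Any using (Any; here; there)
import Data.List.Relation.Unary.Any as Any
import Data.List.Relation.Unary.All as All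
open import Data.List.Membership.Propositional using (_∈_)
open import Data.List.Membership.Propositional.Properties
  using (∈-allFin; ∈-filter⁺; ∈-filter⁻; ∈-map⁺; ∈-map⁻)
open import Data.Product using (∃; _×_; _,_; proj₁; proj₂)
open import Data.Sum using (_⊎_; inj₁; inj₂; [_,_]′)
open import Data.Unit using (⊤; tt)
open import Data.Empty using (⊥-elim)
open import Function using (_∘_; id)
open import Level using (0ℓ)
open import Relation.Nullary using (¬_; Dec; yes; no)
open import Relation.Nullary.Decidable using (_×-dec_; _⊎-dec_)
open import Relation.Unary using (Pred; Decidable; _≐_)
open import Relation.Unary.Properties using (_∪?_)
open import Relation.Binary.PropositionalEquality
  using (_≡_; refl; sym; trans; cong; cong₂; subst; subst₂; module ≡-Reasoning)

open ≡-Reasoning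

count : {A : Set} {P : Pred A 0ℓ} → Decidable P → List A → ℕ
count P? xs = length (filter P? xs)

module _ {A : Set} {P : Pred A 0ℓ} (P? : Decidable P) where

  count-≐ : {Q : Pred A 0ℓ} (Q? : Decidable Q) → P ≐ Q → ∀ xs → count P? xs ≡ count Q? xs
  count-≐ Q? P≐Q xs = cong length (filter-≐ P? Q? P≐Q xs)

  count-++ : ∀ xs ys → count P? (xs ++ ys) ≡ count P? xs + count P? ys
  count-++ xs ys = trans (cong length (filter-++ P? xs ys)) (length-++ (filter P? xs))

  count-all : (∀ x → P x) → ∀ xs → count P? xs ≡ length xs
  count-all P-holds xs = cong length (filter-all P? (All.universal P-holds xs))

  count-none : (∀ x → ¬ P x) → ∀ xs → count P? xs ≡ 0
  count-none ¬P xs = cong length (filter-none P? (All.universal ¬P xs))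

  count-map : {B : Set} (f : B → A) → ∀ xs → count P? (map f xs) ≡ count (P? ∘ f) xs
  count-map f []       = refl
  count-map f (x ∷ xs) with P? (f x)
  ... | yes _ = cong suc (count-map f xs)
  ... | no  _ = count-map f xs

  count-∪ : {Q : Pred A 0ℓ} (Q? : Decidable Q) → (∀ x → P x → ¬ Q x) →
            ∀ xs → count (P? ∪? Q?) xs ≡ count P? xs + count Q? xs
  count-∪ Q? disjoint []       = refl
  count-∪ Q? disjoint (x ∷ xs) with P? x | Q? x
  ... | yes p | yes q = ⊥-elim (disjoint x p q)
  ... | yes _ | no  _ = cong suc (count-∪ Q? disjoint xs)
  ... | no  _ | yes _ = trans (cong suc (count-∪ Q? disjoint xs)) (sym (+-suc _ _))
  ... | no  _ | no  _ = count-∪ Q? disjoint xs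

count-allFin-suc : ∀ {N} {P : Pred (Fin (suc N)) 0ℓ} (P? : Decidable P) →
  count P? (allFin (suc N)) ≡ count P? (Fin.zero ∷ []) + count (P? ∘ Fin.suc) (allFin N)
count-allFin-suc {N} P? = begin
  count P? (allFin (suc N))
    ≡⟨ count-++ P? (Fin.zero ∷ []) _ ⟩
  count P? (Fin.zero ∷ []) + count P? (tabulate Fin.suc)
    ≡⟨ cong (λ ys → count P? (Fin.zero ∷ []) + count P? ys) (sym (map-tabulate id Fin.suc)) ⟩
  count P? (Fin.zero ∷ []) + count P? (map Fin.suc (allFin N))
    ≡⟨ cong (count P? (Fin.zero ∷ []) +_) (count-map P? Fin.suc (allFin N)) ⟩
  count P? (Fin.zero ∷ []) + count (P? ∘ Fin.suc) (allFin N) ∎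

Between : ∀ {N} → ℕ → ℕ → Pred (Fin N) 0ℓ
Between b c y = b ≤ toℕ y × toℕ y ≤ c

Between? : ∀ {N} b c → Decidable (Between {N} b c)
Between? b c y = (b ≤? toℕ y) ×-dec (toℕ y ≤? c)

Between-suc : ∀ {N} b c → (λ (y : Fin N) → Between (suc b) (suc c) (Fin.suc y)) ≐ Between b c
Between-suc b c = (λ (p , q) → s≤s⁻¹ p , s≤s⁻¹ q) , (λ (p , q) → s≤s p , s≤s q)

Between-zero-suc : ∀ {N} c → (λ (y : Fin N) → Between 0 (suc c) (Fin.suc y)) ≐ Between 0 c
Between-zero-suc c = (λ (_ , q) → z≤n , s≤s⁻¹ q) , (λ (_ , q) → z≤n , s≤s q)

count-interval : ∀ N b d → b + d < N → count (Between? b (b + d)) (allFin N) ≡ suc d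
count-interval (suc N) (suc b) d (s≤s b+d<N) = begin
  count (Between? (suc b) (suc b + d)) (allFin (suc N))
    ≡⟨ count-allFin-suc (Between? {suc N} (suc b) (suc b + d)) ⟩
  0 + count (Between? (suc b) (suc b + d) ∘ Fin.suc) (allFin N)
    ≡⟨ count-≐ (Between? (suc b) (suc b + d) ∘ Fin.suc) (Between? b (b + d)) (Between-suc b (b + d)) (allFin N) ⟩
  count (Between? b (b + d)) (allFin N)
    ≡⟨ count-interval N b d b+d<N ⟩
  suc d ∎
count-interval (suc N) zero zero _ = begin
  count (Between? 0 0) (allFin (suc N))
    ≡⟨ count-allFin-suc (Between? {suc N} 0 0) ⟩
  1 + count (Between? 0 0 ∘ Fin.suc) (allFin N)
    ≡⟨ cong suc (count-none (Between? 0 0 ∘ Fin.suc) (λ { _ (_ , ()) }) (allFin N)) ⟩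
  1 ∎
count-interval (suc N) zero (suc d) (s≤s d<N) = begin
  count (Between? 0 (suc d)) (allFin (suc N))
    ≡⟨ count-allFin-suc (Between? {suc N} 0 (suc d)) ⟩
  1 + count (Between? 0 (suc d) ∘ Fin.suc) (allFin N)
    ≡⟨ cong suc (count-≐ (Between? 0 (suc d) ∘ Fin.suc) (Between? 0 d) (Between-zero-suc d) (allFin N)) ⟩
  1 + count (Between? 0 d) (allFin N)
    ≡⟨ cong suc (count-interval N 0 d d<N) ⟩
  suc (suc d) ∎

count-value : ∀ {N} b → b < N → count (λ (a : Fin N) → toℕ a ≟ b) (allFin N) ≡ 1
count-value {N} b b<N = begin
  count (λ a → toℕ a ≟ b) (allFin N)
    ≡⟨ count-≐ (λ a → toℕ a ≟ b) (Between? b (b + 0)) (to , from) (allFin N) ⟩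
  count (Between? b (b + 0)) (allFin N)
    ≡⟨ count-interval N b 0 (subst (_< N) (sym (+-identityʳ b)) b<N) ⟩
  1 ∎
  where
    to : ∀ {a : Fin N} → toℕ a ≡ b → Between b (b + 0) a
    to refl = ≤-refl , m≤m+n _ 0
    from : ∀ {a : Fin N} → Between b (b + 0) a → toℕ a ≡ b
    from (b≤a , a≤b) = ≤-antisym (≤-trans a≤b (≤-reflexive (+-identityʳ b))) b≤a

UnitStep : ℕ → ℕ → Set
UnitStep a b = b ≡ a ⊎ b ≡ suc a

unitStep? : ∀ a b → Dec (UnitStep a b)
unitStep? a b = (b ≟ a) ⊎-dec (b ≟ suc a)

unitStep⇒≤ : ∀ {a b} → UnitStep a b → a ≤ b
unitStep⇒≤ (inj₁ refl) = ≤-refl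
unitStep⇒≤ (inj₂ refl) = n≤1+n _

unitStep⇒dist≤1 : ∀ a b → UnitStep a b → ∣ a - b ∣ ≤ 1
unitStep⇒dist≤1 a .a       (inj₁ refl) = ≤-trans (≤-reflexive (∣n-n∣≡0 a)) z≤n
unitStep⇒dist≤1 a .(suc a) (inj₂ refl) =
  ≤-reflexive (trans (m≤n⇒∣m-n∣≡n∸m (n≤1+n a)) (m+n∸n≡m 1 a))

≤∧dist≤1⇒unitStep : ∀ a b → a ≤ b → ∣ a - b ∣ ≤ 1 → UnitStep a b
≤∧dist≤1⇒unitStep zero    zero          _         _         = inj₁ refl
≤∧dist≤1⇒unitStep zero    (suc zero)    _         _         = inj₂ refl
≤∧dist≤1⇒unitStep zero    (suc (suc b)) _         (s≤s ())
≤∧dist≤1⇒unitStep (suc a) (suc b)       (s≤s a≤b) dist with ≤∧dist≤1⇒unitStep a b a≤b dist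
... | inj₁ b≡a  = inj₁ (cong suc b≡a)
... | inj₂ b≡1+a = inj₂ (cong suc b≡1+a)

Walk : ∀ {N m} → Vec (Fin N) (suc m) → Set
Walk (x ∷ [])    = ⊤
Walk (x ∷ y ∷ v) = UnitStep (toℕ x) (toℕ y) × Walk (y ∷ v)

walk? : ∀ {N m} (v : Vec (Fin N) (suc m)) → Dec (Walk v)
walk? (x ∷ [])    = yes tt
walk? (x ∷ y ∷ v) = unitStep? (toℕ x) (toℕ y) ×-dec walk? (y ∷ v)

start : ∀ {N m} → Vec (Fin N) (suc m) → Fin N
start (x ∷ _) = x

end : ∀ {N m} → Vec (Fin N) (suc m) → Fin N
end (x ∷ [])    = x
end (x ∷ y ∷ v) = end (y ∷ v)

walk-bounds : ∀ {N m} (v : Vec (Fin N) (suc m)) → Walk v → ∀ i →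
  Between (toℕ (start v)) (toℕ (end v)) (lookup v i)
walk-bounds (a ∷ [])    _       Fin.zero    = ≤-refl , ≤-refl
walk-bounds (a ∷ b ∷ v) (s , w) Fin.zero    =
  ≤-refl , ≤-trans (unitStep⇒≤ s) (proj₂ (walk-bounds (b ∷ v) w Fin.zero))
walk-bounds (a ∷ b ∷ v) (s , w) (Fin.suc i) =
  let b≤vᵢ , vᵢ≤end = walk-bounds (b ∷ v) w i in ≤-trans (unitStep⇒≤ s) b≤vᵢ , vᵢ≤end

start≤end : ∀ {N m} (v : Vec (Fin N) (suc m)) → Walk v → toℕ (start v) ≤ toℕ (end v)
start≤end (a ∷ v) w = proj₂ (walk-bounds (a ∷ v) w Fin.zero)

walk-hits : ∀ {N m} (v : Vec (Fin N) (suc m)) → Walk v → ∀ y →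
  Between (toℕ (start v)) (toℕ (end v)) y → ∃ λ i → lookup v i ≡ y
walk-hits (a ∷ [])    _       y (a≤y , y≤a) = Fin.zero , FinP.toℕ-injective (≤-antisym a≤y y≤a)
walk-hits (a ∷ b ∷ v) (s , w) y (a≤y , y≤end) with toℕ y ≟ toℕ a
... | yes y≡a = Fin.zero , FinP.toℕ-injective (sym y≡a)
... | no  y≢a =
  let i , vᵢ≡y = walk-hits (b ∷ v) w y (b≤y , y≤end) in Fin.suc i , vᵢ≡y
  where
    a<y : toℕ a < toℕ y
    a<y = ≤∧≢⇒< a≤y (y≢a ∘ sym)
    b≤y : toℕ b ≤ toℕ y
    b≤y = [ (λ b≡a → subst (_≤ toℕ y) (sym b≡a) a≤y)
          , (λ b≡1+a → subst (_≤ toℕ y) (sym b≡1+a) a<y) ]′ s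

-- We work with value tables Fin m → Fin N (domain and codomain of different
-- sizes, so that tables can be shortened); for m = N = n these are IsOCT.

OrderPreservingᵛ : ∀ {N m} → Vec (Fin N) m → Set
OrderPreservingᵛ {m = m} v = ∀ (x y : Fin m) → x Fin.≤ y → lookup v x Fin.≤ lookup v y

Contractionᵛ : ∀ {N m} → Vec (Fin N) m → Set
Contractionᵛ {m = m} v =
  ∀ (x y : Fin m) → ∣ toℕ (lookup v x) - toℕ (lookup v y) ∣ ≤ ∣ toℕ x - toℕ y ∣

IsOCTᵛ : ∀ {N m} → Vec (Fin N) m → Set
IsOCTᵛ v = OrderPreservingᵛ v × Contractionᵛ v

-- comparing neighbouring points shows that an OCT table is a walk
-- (its tail, the restriction to the points after the first, is again OCT)
oct⇒walk : ∀ {N m} (v : Vec (Fin N) (suc m)) → IsOCTᵛ v → Walk v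
oct⇒walk (a ∷ [])    _         = tt
oct⇒walk (a ∷ b ∷ v) (op , ct) =
  ≤∧dist≤1⇒unitStep (toℕ a) (toℕ b) (op Fin.zero (Fin.suc Fin.zero) z≤n) (ct Fin.zero (Fin.suc Fin.zero)) ,
  oct⇒walk (b ∷ v) ( (λ x y x≤y → op (Fin.suc x) (Fin.suc y) (s≤s x≤y))
                   , (λ x y → ct (Fin.suc x) (Fin.suc y)))

walk⇒orderPreserving : ∀ {N m} (v : Vec (Fin N) (suc m)) → Walk v → OrderPreservingᵛ v
walk⇒orderPreserving (a ∷ v)     w       Fin.zero    y           _         = proj₁ (walk-bounds (a ∷ v) w y)
walk⇒orderPreserving (a ∷ b ∷ v) (_ , w) (Fin.suc x) (Fin.suc y) (s≤s x≤y) =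
  walk⇒orderPreserving (b ∷ v) w x y x≤y

-- a walk moves at most one unit per step, so its i-th value is within i of its start
walk-distance-from-start : ∀ {N m} (v : Vec (Fin N) (suc m)) → Walk v → ∀ i →
  ∣ toℕ (start v) - toℕ (lookup v i) ∣ ≤ toℕ i
walk-distance-from-start (a ∷ v)     _       Fin.zero    = ≤-reflexive (∣n-n∣≡0 (toℕ a))
walk-distance-from-start (a ∷ b ∷ v) (s , w) (Fin.suc i) =
  ≤-trans (∣-∣-triangle (toℕ a) (toℕ b) _)
          (+-mono-≤ (unitStep⇒dist≤1 (toℕ a) (toℕ b) s) (walk-distance-from-start (b ∷ v) w i))

walk⇒contraction : ∀ {N m} (v : Vec (Fin N) (suc m)) → Walk v → Contractionᵛ v
walk⇒contraction (a ∷ v)     w       Fin.zero    y           = walk-distance-from-start (a ∷ v) w y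
walk⇒contraction (a ∷ v)     w       (Fin.suc x) Fin.zero    =
  subst (_≤ suc (toℕ x)) (∣-∣-comm (toℕ a) _) (walk-distance-from-start (a ∷ v) w (Fin.suc x))
walk⇒contraction (a ∷ b ∷ v) (_ , w) (Fin.suc x) (Fin.suc y) = walk⇒contraction (b ∷ v) w x y

walk⇒oct : ∀ {N m} (v : Vec (Fin N) (suc m)) → Walk v → IsOCTᵛ v
walk⇒oct v w = walk⇒orderPreserving v w , walk⇒contraction v w

maxList-upper : ∀ {z} xs → z ∈ xs → z ≤ maxList xs
maxList-upper (x ∷ xs) (here refl) = m≤m⊔n x (maxList xs)
maxList-upper (x ∷ xs) (there z∈xs) = ≤-trans (maxList-upper xs z∈xs) (m≤n⊔m x (maxList xs))

maxList-least : ∀ {B} xs → (∀ {z} → z ∈ xs → z ≤ B) → maxList xs ≤ B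
maxList-least []       _     = z≤n
maxList-least (x ∷ xs) bound = ⊔-lub (bound (here refl)) (maxList-least xs (bound ∘ there))

module _ {m} (α : Transformation (suc m)) (w : Walk α) where

  private
    first last : ℕ
    first = toℕ (start α)
    last  = toℕ (end α)

  image-walk : image α ≡ filter (Between? first last) (allFin (suc m))
  image-walk = filter-≐ (λ y → Any.any? (λ x → (x · α) FinP.≟ y) (allFin (suc m)))
                        (Between? first last) (in-image⇒between , between⇒in-image) (allFin (suc m))
    where
      in-image⇒between : ∀ {y} → Any (λ x → x · α ≡ y) (allFin (suc m)) → Between first last y
      in-image⇒between x·α≡y with Any.satisfied x·α≡y
      ... | x , refl = walk-bounds α w x
      between⇒in-image : ∀ {y} → Between first last y → Any (λ x → x · α ≡ y) (allFin (suc m))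
      between⇒in-image {y} y∈[first,last] =
        let x , x·α≡y = walk-hits α w y y∈[first,last] in Any.map (λ { refl → x·α≡y }) (∈-allFin x)

  h-walk : h α ≡ suc (last ∸ first)
  h-walk = begin
    h α
      ≡⟨ cong length image-walk ⟩
    count (Between? first last) (allFin (suc m))
      ≡⟨ cong (λ c → count (Between? first c) (allFin (suc m))) (sym first+gap≡last) ⟩
    count (Between? first (first + gap)) (allFin (suc m))
      ≡⟨ count-interval (suc m) first gap (subst (_< suc m) (sym first+gap≡last) (FinP.toℕ<n (end α))) ⟩
    suc gap ∎
    where
      gap : ℕ
      gap = last ∸ first
      first+gap≡last : first + gap ≡ last
      first+gap≡last = m+[n∸m]≡n (start≤end α w)

  w⁺-walk : w⁺ α ≡ suc last
  w⁺-walk rewrite image-walk = ≤-antisym (maxList-least _ below-last) (maxList-upper _ last∈values)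
    where
      interval : List (Fin (suc m))
      interval = filter (Between? first last) (allFin (suc m))
      value : Fin (suc m) → ℕ
      value y = suc (toℕ y)
      below-last : ∀ {z} → z ∈ map value interval → z ≤ suc last
      below-last z∈values with ∈-map⁻ value z∈values
      ... | y , y∈interval , refl =
        s≤s (proj₂ (proj₂ (∈-filter⁻ (Between? first last) {xs = allFin (suc m)} y∈interval)))
      last∈values : suc last ∈ map value interval
      last∈values =
        ∈-map⁺ value (∈-filter⁺ (Between? first last) (∈-allFin (end α)) (start≤end α w , ≤-refl))

WalkFrom : ∀ {N m} → ℕ → ℕ → Pred (Vec (Fin N) (suc m)) 0ℓ
WalkFrom b c v = Walk v × toℕ (start v) ≡ b × toℕ (end v) ≡ c

walkFrom? : ∀ {N m} b c → Decidable (WalkFrom {N} {m} b c)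
walkFrom? b c v = walk? v ×-dec (toℕ (start v) ≟ b) ×-dec (toℕ (end v) ≟ c)

-- If P (a ∷ v) holds exactly when the head a has value b and R v holds,
-- then each table counted by R extends to exactly one table counted by P.
count-extend : ∀ {N m} {P : Pred (Vec (Fin N) (suc m)) 0ℓ} {R : Pred (Vec (Fin N) m) 0ℓ}
  (P? : Decidable P) (R? : Decidable R) {b} → b < N →
  (∀ v → (λ a → P (a ∷ v)) ≐ (λ a → toℕ a ≡ b × R v)) →
  count P? (allVecs (suc m) N) ≡ count R? (allVecs m N)
count-extend {N} {P = P} {R} P? R? {b} b<N P≐ = extensions (allVecs _ N)
  where
    heads : ∀ v → count P? (map (_∷ v) (allFin N)) ≡ count R? (v ∷ [])
    heads v with R? v
    ... | yes Rv = begin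
      count P? (map (_∷ v) (allFin N))
        ≡⟨ count-map P? (_∷ v) (allFin N) ⟩
      count (P? ∘ (_∷ v)) (allFin N)
        ≡⟨ count-≐ _ (λ a → toℕ a ≟ b) (proj₁ ∘ proj₁ (P≐ v) , λ a≡b → proj₂ (P≐ v) (a≡b , Rv))
                   (allFin N) ⟩
      count (λ a → toℕ a ≟ b) (allFin N)
        ≡⟨ count-value b b<N ⟩
      1 ∎
    ... | no ¬Rv = trans (count-map P? (_∷ v) (allFin N))
                         (count-none _ (λ a → ¬Rv ∘ proj₂ ∘ proj₁ (P≐ v)) (allFin N))
    extensions : ∀ L → count P? (concatMap (λ v → map (_∷ v) (allFin N)) L) ≡ count R? L
    extensions []      = refl
    extensions (v ∷ L) = begin
      count P? (map (_∷ v) (allFin N) ++ concatMap (λ v → map (_∷ v) (allFin N)) L)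
        ≡⟨ count-++ P? (map (_∷ v) (allFin N)) _ ⟩
      count P? (map (_∷ v) (allFin N)) + count P? (concatMap (λ v → map (_∷ v) (allFin N)) L)
        ≡⟨ cong₂ _+_ (heads v) (extensions L) ⟩
      count R? (v ∷ []) + count R? L
        ≡⟨ count-++ R? (v ∷ []) L ⟨
      count R? (v ∷ L) ∎

walkFrom-single : ∀ {N} b c → (λ (a : Fin N) → WalkFrom b c (a ∷ [])) ≐ (λ a → toℕ a ≡ b × b ≡ c)
walkFrom-single b c = (λ (_ , a≡b , a≡c) → a≡b , trans (sym a≡b) a≡c)
                    , (λ (a≡b , b≡c) → tt , a≡b , trans a≡b b≡c)

walkFrom-cons : ∀ {N m} b c (v : Vec (Fin N) (suc m)) →
  (λ a → WalkFrom b c (a ∷ v)) ≐ (λ a → toℕ a ≡ b × (WalkFrom b c v ⊎ WalkFrom (suc b) c v))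
walkFrom-cons b c (x ∷ u) = to , from
  where
    Continuation : Set
    Continuation = WalkFrom b c (x ∷ u) ⊎ WalkFrom (suc b) c (x ∷ u)
    to : ∀ {a} → WalkFrom b c (a ∷ x ∷ u) → toℕ a ≡ b × Continuation
    to ((inj₁ x≡a , w) , a≡b , e) = a≡b , inj₁ (w , trans x≡a a≡b , e)
    to ((inj₂ x≡1+a , w) , a≡b , e) = a≡b , inj₂ (w , trans x≡1+a (cong suc a≡b) , e)
    from : ∀ {a} → toℕ a ≡ b × Continuation → WalkFrom b c (a ∷ x ∷ u)
    from (a≡b , inj₁ (w , x≡b , e))   = (inj₁ (trans x≡b (sym a≡b)) , w) , a≡b , e
    from (a≡b , inj₂ (w , x≡1+b , e)) = (inj₂ (trans x≡1+b (cong suc (sym a≡b))) , w) , a≡b , e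

start<N : ∀ {N b c d} → b + d ≡ c → c < N → b < N
start<N {b = b} {d = d} refl c<N = ≤-<-trans (m≤m+n b d) c<N

count-walks : ∀ {N} m {b c d} → b + d ≡ c → c < N →
  count (walkFrom? {N} b c) (allVecs (suc m) N) ≡ m C d
count-walks {N} zero {b} {c} {d} b+d≡c c<N = begin
  count (walkFrom? b c) (allVecs 1 N)
    ≡⟨ count-extend {N} {0} (walkFrom? b c) (λ _ → b ≟ c) (start<N b+d≡c c<N)
                    (λ { [] → walkFrom-single b c }) ⟩
  count (λ _ → b ≟ c) (allVecs 0 N)
    ≡⟨ endpoints-agree d b+d≡c ⟩
  0 C d ∎
  where
    endpoints-agree : ∀ d → b + d ≡ c → count (λ _ → b ≟ c) (allVecs 0 N) ≡ 0 C d
    endpoints-agree zero    b+0≡c   =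
      count-all (λ _ → b ≟ c) (λ _ → trans (sym (+-identityʳ b)) b+0≡c) (allVecs 0 N)
    endpoints-agree (suc d) b+1+d≡c =
      count-none (λ _ → b ≟ c) (λ _ b≡c → m+1+n≢m b (trans b+1+d≡c (sym b≡c))) (allVecs 0 N)
count-walks {N} (suc m) {b} {c} {d} b+d≡c c<N = begin
  count (walkFrom? b c) (allVecs (suc (suc m)) N)
    ≡⟨ count-extend {N} {suc m} (walkFrom? b c) (walkFrom? b c ∪? walkFrom? (suc b) c) (start<N b+d≡c c<N)
                    (walkFrom-cons b c) ⟩
  count (walkFrom? b c ∪? walkFrom? (suc b) c) (allVecs (suc m) N)
    ≡⟨ count-∪ (walkFrom? b c) (walkFrom? (suc b) c) different-starts (allVecs (suc m) N) ⟩
  count (walkFrom? b c) (allVecs (suc m) N) + count (walkFrom? (suc b) c) (allVecs (suc m) N)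
    ≡⟨ pascal d b+d≡c ⟩
  suc m C d ∎
  where
    different-starts : ∀ v → WalkFrom b c v → ¬ WalkFrom (suc b) c v
    different-starts _ (_ , s≡b , _) (_ , s≡1+b , _) = 1+n≢n (trans (sym s≡1+b) s≡b)
    -- Pascal's rule; for d = 0 no walk to c = b can start at b + 1
    pascal : ∀ d → b + d ≡ c →
      count (walkFrom? b c) (allVecs (suc m) N) + count (walkFrom? (suc b) c) (allVecs (suc m) N) ≡ suc m C d
    pascal zero b+0≡c =
      cong₂ _+_ (count-walks m b+0≡c c<N) (count-none (walkFrom? (suc b) c) no-descent (allVecs (suc m) N))
      where
        no-descent : ∀ v → ¬ WalkFrom (suc b) c v
        no-descent v (w , s≡1+b , e≡c) =
          1+n≰n (subst₂ _≤_ s≡1+b (trans e≡c (sym (trans (sym (+-identityʳ b)) b+0≡c))) (start≤end v w))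
    pascal (suc d) b+1+d≡c = begin
      count (walkFrom? b c) (allVecs (suc m) N) + count (walkFrom? (suc b) c) (allVecs (suc m) N)
        ≡⟨ cong₂ _+_ (count-walks m b+1+d≡c c<N) (count-walks m (trans (sym (+-suc b d)) b+1+d≡c) c<N) ⟩
      m C suc d + m C d   ≡⟨ +-comm (m C suc d) (m C d) ⟩
      m C d + m C suc d   ≡⟨ nCk+nC[k+1]≡[n+1]C[k+1] m d ⟩
      suc m C suc d       ∎

oct-shape≐walkFrom : ∀ {m d c} → d ≤ c →
  (λ (α : Transformation (suc m)) → IsOCT α × h α ≡ suc d × w⁺ α ≡ suc c) ≐ WalkFrom (c ∸ d) c
oct-shape≐walkFrom {m} {d} {c} d≤c = to , from
  where
    to : ∀ {α : Transformation (suc m)} → IsOCT α × h α ≡ suc d × w⁺ α ≡ suc c → WalkFrom (c ∸ d) c α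
    to {α} (oct , h≡1+d , w⁺≡1+c) = w , start≡c∸d , end≡c
      where
        w = oct⇒walk α oct
        end≡c : toℕ (end α) ≡ c
        end≡c = suc-injective (trans (sym (w⁺-walk α w)) w⁺≡1+c)
        gap≡d : toℕ (end α) ∸ toℕ (start α) ≡ d
        gap≡d = suc-injective (trans (sym (h-walk α w)) h≡1+d)
        start≡c∸d : toℕ (start α) ≡ c ∸ d
        start≡c∸d = begin
          toℕ (start α)                                   ≡⟨ m∸[m∸n]≡n (start≤end α w) ⟨
          toℕ (end α) ∸ (toℕ (end α) ∸ toℕ (start α))     ≡⟨ cong₂ _∸_ end≡c gap≡d ⟩
          c ∸ d                                           ∎
    from : ∀ {α : Transformation (suc m)} → WalkFrom (c ∸ d) c α → IsOCT α × h α ≡ suc d × w⁺ α ≡ suc c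
    from {α} (w , start≡c∸d , end≡c) = walk⇒oct α w , h≡1+d , trans (w⁺-walk α w) (cong suc end≡c)
      where
        h≡1+d : h α ≡ suc d
        h≡1+d = begin
          h α                                   ≡⟨ h-walk α w ⟩
          suc (toℕ (end α) ∸ toℕ (start α))     ≡⟨ cong suc (cong₂ _∸_ end≡c start≡c∸d) ⟩
          suc (c ∸ (c ∸ d))                     ≡⟨ cong suc (m∸[m∸n]≡n d≤c) ⟩
          suc d                                 ∎

corollary2p5 : (n p k : ℕ) → 1 ≤ n → 1 ≤ p → p ≤ k → k ≤ n →
    countOCT n p k ≡ (n ∸ 1) C (p ∸ 1)
corollary2p5 (suc m) (suc d) (suc c) _ _ (s≤s d≤c) (s≤s c≤m) = begin
  countOCT (suc m) (suc d) (suc c)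
    ≡⟨ count-≐ _ (walkFrom? (c ∸ d) c) (oct-shape≐walkFrom d≤c) (allTransformations (suc m)) ⟩
  count (walkFrom? (c ∸ d) c) (allVecs (suc m) (suc m))
    ≡⟨ count-walks m (m∸n+n≡m d≤c) (s≤s c≤m) ⟩
  m C d ∎
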